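{- There is an absolute constant $C>0$ such that the following holds. Let $\mathcal{G}$ be a nontrivial minor-closed graph class, and let $p$ be the smallest number of vertices of a forbidden minor of $\mathcal{G}$. Then every graph $G$ in the lower $\mathcal{G}$ switching class satisfies $|V(G)|\le C\, p\sqrt{p}$ (i.e., $|V(G)| = O(p\sqrt{p})$).
   Context: All graphs are finite and simple. For a graph $G$ and $A\subseteq V(G)$, the switching $S(G,A)$ is the graph on $V(G)$ whose edges are the edges of $G$ with both ends in $A$, the edges of $G$ with both ends outside $A$, and all pairs $uv$ with $u\in A$, $v\notin A$, $uv\notin E(G)$. Two graphs are switching equivalent if one is isomorphic to $S(G,A)$ for the other graph $G$ and some $A$. For a graph class $\mathcal{G}$, the lower $\mathcal{G}$ switching class is the class of all graphs $G$ such that every graph switching equivalent to $G$ is in $\mathcal{G}$. A graph class is minor-closed if every minor of a graph in the class is in the class; it is nontrivial if some graph is not in it. The forbidden minors of a minor-closed class $\mathcal{G}$ are the graphs not in $\mathcal{G}$ all of whose proper minors are in $\mathcal{G}$; a graph is in $\mathcal{G}$ iff it contains no forbidden minor as a minor. -}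

module Defs where

open import Data.Nat using (ℕ)
open import Data.Fin using (Fin)
open import Data.Bool using (Bool; true; false; _xor_)
open import Data.Maybe using (Maybe; just)
open import Data.Product using (Σ; ∃; _×_; _,_)
open import Data.Empty using (⊥)
open import Relation.Nullary using (¬_)
open import Relation.Binary.PropositionalEquality using (_≡_; refl)
open import Function.Bundles using (_↔_; Inverse)
open import Level using (0ℓ)

record Graph (n : ℕ) : Set where
  field
    adj    : Fin n → Fin n → Bool
    adjSym : ∀ u v → adj u v ≡ adj v u
    loopless : ∀ u → adj u u ≡ false
open Graph public

_≅_ : ∀ {m n} → Graph m → Graph n → Set
_≅_ {m} {n} H G =
  Σ (Fin m ↔ Fin n) λ f →
    ∀ u v → adj H u v ≡ adj G (Inverse.to f u) (Inverse.to f v)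

private
  swSym : ∀ a b e → (a xor b) xor e ≡ (b xor a) xor e
  swSym false false e = refl
  swSym false true  e = refl
  swSym true  false e = refl
  swSym true  true  e = refl

  swLoop : ∀ a → (a xor a) xor false ≡ false
  swLoop false = refl
  swLoop true  = refl

switch : ∀ {n} → Graph n → (Fin n → Bool) → Graph n
adj (switch G A) u v = (A u xor A v) xor adj G u v
adjSym (switch G A) u v rewrite adjSym G u v = swSym (A u) (A v) (adj G v u)
loopless (switch G A) u rewrite loopless G u = swLoop (A u)

SwitchingEquivalent : ∀ {m n} → Graph m → Graph n → Set
SwitchingEquivalent {m} {n} H G = Σ (Fin n → Bool) λ A → H ≅ switch G A

data WalkIn {n} (G : Graph n) (P : Fin n → Set) : Fin n → Fin n → Set where
  here : ∀ {u} → P u → WalkIn G P u u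
  step : ∀ {u w v} → P u → adj G u w ≡ true → WalkIn G P w v → WalkIn G P u v

-- H is a minor of G: there is a model of H in G, i.e. disjoint nonempty
-- connected branch sets φ⁻¹(i) (vertices sent to nothing are deleted),
-- with an edge of G between branch sets i and j for every edge ij of H.
_≼_ : ∀ {m n} → Graph m → Graph n → Set
_≼_ {m} {n} H G =
  Σ (Fin n → Maybe (Fin m)) λ φ →
      (∀ i → ∃ λ u → φ u ≡ just i)
    × (∀ i u v → φ u ≡ just i → φ v ≡ just i →
         WalkIn G (λ w → φ w ≡ just i) u v)
    × (∀ i j → adj H i j ≡ true →
         ∃ λ u → ∃ λ v → φ u ≡ just i × φ v ≡ just j × adj G u v ≡ true)

_≺_ : ∀ {m n} → Graph m → Graph n → Set
H ≺ G = H ≼ G × ¬ (H ≅ G)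

GraphClass : Set₁
GraphClass = ∀ {n} → Graph n → Set

MinorClosed : GraphClass → Set
MinorClosed 𝒢 = ∀ {m n} (G : Graph n) (H : Graph m) → 𝒢 G → H ≼ G → 𝒢 H

Nontrivial : GraphClass → Set
Nontrivial 𝒢 = ∃ λ n → Σ (Graph n) λ G → ¬ 𝒢 G

ForbiddenMinor : GraphClass → ∀ {n} → Graph n → Set
ForbiddenMinor 𝒢 {n} H = ¬ 𝒢 H × (∀ {m} (H' : Graph m) → H' ≺ H → 𝒢 H')

MinForbiddenMinorSize : GraphClass → ℕ → Set
MinForbiddenMinorSize 𝒢 p =
    (Σ (Graph p) λ H → ForbiddenMinor 𝒢 H)
  × (∀ {m} (H : Graph m) → ForbiddenMinor 𝒢 H → p Data.Nat.≤ m)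

LowerSwitchingClass : GraphClass → GraphClass
LowerSwitchingClass 𝒢 {n} G = ∀ {m} (H : Graph m) → SwitchingEquivalent H G → 𝒢 H

{-# OPTIONS --safe #-}

-- Choose s with p < 2^s ≤ 2p + 1.  If n > p(s + 2) + ps, some switching of G has a K_p minor,
-- hence every graph on p vertices as a minor, in particular a forbidden minor of 𝒢.
--
-- Greedily: switching at the neighbourhood of a vertex x makes the adjacency of a and b the
-- parity of the triangle x a b.  If every vertex has fewer than s non-neighbours there, the
-- remaining > ps vertices contain a p-clique (Turán-type greedy).  Otherwise x, a vertex y
-- and s non-neighbours w of y form a block in which every triangle x y w is even; remove it
-- and repeat.  Given p disjoint blocks, switch so that each y is adjacent to its x; triangle
-- parity is switching invariant, so every w becomes adjacent to x or y and each block is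
-- connected.  The s switching bits on the leaves of block u are still free, and since
-- p < 2^s they can be chosen to differ from the adjacency pattern of every centre x_t on those
-- leaves, giving an edge from block t to block u.  So n ≤ 2p(s + 1), and
-- (s + 1)² ≤ 4·2^s ≤ 4(2p + 1) gives n² ≤ 48p³.
module Submission where

open import Defs
open import Data.Bool using (Bool; true; false; not; _xor_) renaming (_≟_ to _≟ᵇ_)
open import Data.Bool.Properties
  using (xor-annihilates-not; not-distribˡ-xor; not-distribʳ-xor; xor-inverseˡ; ¬-not; not-¬)
open import Data.Empty using (⊥-elim)
open import Data.Fin using (Fin; zero; suc; _≟_; inject≤)
open import Data.Fin.Properties using (any?; inject≤-injective)
open import Data.List using (List; []; _∷_; length; filter; lookup; map; tabulate; allFin)
open import Data.List.Properties
  using (filter-accept; filter-reject; filter-all; length-map; length-tabulate)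
open import Data.List.Membership.Propositional using (_∈_; _∉_; find)
open import Data.List.Membership.Propositional.Properties
  using (∈-filter⁺; ∈-filter⁻; ∈-lookup; ∈-map⁺; ∈-tabulate⁺)
open import Data.List.Relation.Unary.All as All using (All; []; _∷_)
import Data.List.Relation.Unary.All.Properties as AllP
open import Data.List.Relation.Unary.All.Properties using (All¬⇒¬Any; ¬Any⇒All¬)
open import Data.List.Relation.Unary.Any as Any using (here; there)
open import Data.List.Relation.Binary.Sublist.Propositional using (_∷ʳ_)
open import Data.List.Relation.Binary.Sublist.Propositional.Properties
  using (filter⁺; filter-⊆; length-mono-≤)
open import Data.List.Relation.Unary.AllPairs using ([]; _∷_)
open import Data.List.Relation.Unary.Unique.Propositional using (Unique)
import Data.List.Relation.Unary.Unique.Propositional.Properties as Unique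
open import Data.Maybe using (Maybe; just; nothing)
open import Data.Nat using (ℕ; zero; suc; _≤_; _<_; _*_; _+_; _^_; z≤n; s≤s; _<?_)
open import Data.Nat.Properties
  using (+-suc; +-identityʳ; +-comm; +-assoc; +-cancelˡ-<; +-mono-≤; +-monoˡ-≤; +-monoʳ-<;
         *-mono-≤; *-monoʳ-≤; *-monoˡ-≤; m≤n+m; m≤m+n; n≤1+n; m<m+n; ≤-refl; ≤-trans; ≤-pred;
         <-≤-trans; ≤∧≮⇒≡; ≮⇒≥; module ≤-Reasoning)
open import Data.Nat.Tactic.RingSolver using (solve-∀)
open import Data.Product as Product using (Σ; ∃; ∃₂; _×_; _,_; proj₁; proj₂)
open import Data.Sum as Sum using (_⊎_; inj₁; inj₂)
open import Data.Vec.Functional using (Vector; head; tail) renaming (_∷_ to _∷ᵛ_)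
open import Function using (_∘_; id)
open import Function.Construct.Identity using (↔-id)
open import Relation.Nullary using (¬_; ¬?; yes; no; contradiction)
open import Relation.Unary using (Pred; Decidable)
open import Relation.Unary.Properties using (∁?)
open import Relation.Binary.Definitions using (DecidableEquality)
open import Relation.Binary.PropositionalEquality
  using (_≡_; _≢_; refl; sym; trans; cong; cong₂; subst; ≢-sym; module ≡-Reasoning)

-- Lists and Boolean vectors

2*m≡m+m : ∀ m → 2 * m ≡ m + m
2*m≡m+m m = cong (m +_) (+-identityʳ m)

half-< : ∀ {a b m} → a + b < 2 * m → a < m ⊎ b < m
half-< {a} {b} {m} a+b<2m with a <? m
... | yes a<m = inj₁ a<m
... | no  a≮m = inj₂ (+-cancelˡ-< a b m (<-≤-trans a+b<2m (begin
  2 * m  ≡⟨ 2*m≡m+m m ⟩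
  m + m  ≤⟨ +-monoˡ-≤ m (≮⇒≥ a≮m) ⟩
  a + m  ∎)))
  where open ≤-Reasoning

module _ {a p} {A : Set a} {P : Pred A p} (P? : Decidable P) where

  length-filter-∁ : ∀ xs → length (filter P? xs) + length (filter (∁? P?) xs) ≡ length xs
  length-filter-∁ []       = refl
  length-filter-∁ (x ∷ xs) with P? x
  ... | yes _ = cong suc (length-filter-∁ xs)
  ... | no  _ = trans (+-suc _ _) (cong suc (length-filter-∁ xs))

module Removal {a} {A : Set a} (_≟ᴬ_ : DecidableEquality A) where

  private
    ≢? : ∀ y → Decidable (_≢ y)
    ≢? y z = ¬? (z ≟ᴬ y)

  remove : A → List A → List A
  remove y = filter (≢? y)

  _∖_ : List A → List A → List A
  xs ∖ []       = xs
  xs ∖ (y ∷ ys) = remove y xs ∖ ys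

  ∈-∖⁻ : ∀ {z} xs ys → z ∈ xs ∖ ys → z ∈ xs × z ∉ ys
  ∈-∖⁻ xs []       z∈ = z∈ , λ ()
  ∈-∖⁻ xs (y ∷ ys) z∈ with ∈-∖⁻ (remove y xs) ys z∈
  ... | z∈r , z∉ys with ∈-filter⁻ (≢? y) z∈r
  ...   | z∈xs , z≢y = z∈xs , λ { (here z≡y) → z≢y z≡y ; (there z∈ys) → z∉ys z∈ys }

  ∖-unique : ∀ {xs} ys → Unique xs → Unique (xs ∖ ys)
  ∖-unique []       u = u
  ∖-unique (y ∷ ys) u = ∖-unique ys (Unique.filter⁺ (≢? y) u)

  length-remove : ∀ {xs y} → Unique xs → y ∈ xs → suc (length (remove y xs)) ≡ length xs
  length-remove {y ∷ xs} {y} (y≢xs ∷ _) (here refl) =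
    cong (suc ∘ length) (trans (filter-reject (≢? y) (λ y≢y → y≢y refl))
                               (filter-all (≢? y) (All.map ≢-sym y≢xs)))
  length-remove {x ∷ xs} {y} (x≢xs ∷ u) (there y∈xs) =
    trans (cong (suc ∘ length) (filter-accept (≢? y) (All.lookup x≢xs y∈xs)))
          (cong suc (length-remove u y∈xs))

  length-∖ : ∀ {xs ys} → Unique xs → Unique ys → All (_∈ xs) ys →
             length (xs ∖ ys) + length ys ≡ length xs
  length-∖ {ys = []} _ _ _ = +-identityʳ _
  length-∖ {xs} {y ∷ ys} ux (y≢ys ∷ uys) (y∈xs ∷ ys⊆xs) = begin
    length (remove y xs ∖ ys) + suc (length ys)  ≡⟨ +-suc _ _ ⟩
    suc (length (remove y xs ∖ ys) + length ys)  ≡⟨ cong suc (length-∖ (Unique.filter⁺ (≢? y) ux)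
                                                                          uys ys⊆remove) ⟩
    suc (length (remove y xs))                   ≡⟨ length-remove ux y∈xs ⟩
    length xs                                    ∎
    where
    open ≡-Reasoning
    ys⊆remove : All (_∈ remove y xs) ys
    ys⊆remove = All.zipWith (λ (z∈xs , y≢z) → ∈-filter⁺ (≢? y) z∈xs (y≢z ∘ sym))
                            (ys⊆xs , y≢ys)

lookup-injective : ∀ {a} {A : Set a} {xs : List A} → Unique xs →
                   ∀ {i j} → lookup xs i ≡ lookup xs j → i ≡ j
lookup-injective {xs = x ∷ xs} _          {zero}  {zero}  _ = refl
lookup-injective {xs = x ∷ xs} (x≢xs ∷ _) {zero}  {suc j} e =
  contradiction e (All.lookup x≢xs (∈-lookup j))
lookup-injective {xs = x ∷ xs} (x≢xs ∷ _) {suc i} {zero}  e =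
  contradiction (sym e) (All.lookup x≢xs (∈-lookup i))
lookup-injective {xs = x ∷ xs} (_ ∷ u)    {suc i} {suc j} e = cong suc (lookup-injective u e)

∷ᵛ-injective : ∀ {a} {A : Set a} {m} {x : A} {f : Vector A m} → (∀ i → f i ≢ x) →
               (∀ {i j} → f i ≡ f j → i ≡ j) → ∀ {i j} → (x ∷ᵛ f) i ≡ (x ∷ᵛ f) j → i ≡ j
∷ᵛ-injective _   _     {zero}  {zero}  _ = refl
∷ᵛ-injective f≢x _     {zero}  {suc j} e = contradiction (sym e) (f≢x j)
∷ᵛ-injective f≢x _     {suc i} {zero}  e = contradiction e (f≢x i)
∷ᵛ-injective _   f-inj {suc i} {suc j} e = cong suc (f-inj e)

Differs : ∀ {s} → Vector Bool s → Vector Bool s → Set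
Differs c v = ∃ λ i → c i ≢ v i

differing-step : ∀ {s} → (∀ ws → length ws < 2 ^ s → ∃ λ c → All (Differs c) ws) →
  ∀ (vs : List (Vector Bool (suc s))) b {p} {P : Pred (Vector Bool (suc s)) p} (P? : Decidable P) →
  (∀ {v} → ¬ P v → b ≢ head v) → length (filter P? vs) < 2 ^ s → ∃ λ c → All (Differs c) vs
differing-step {s} differing vs b P? b≢head few
  with differing (map tail (filter P? vs)) (subst (_< 2 ^ s) (sym (length-map tail (filter P? vs))) few)
... | c , c-differs = b ∷ᵛ c , All.tabulate differs
  where
  differs : ∀ {v} → v ∈ vs → Differs (b ∷ᵛ c) v
  differs {v} v∈vs with P? v
  ... | yes pv = let (i , ne) = All.lookup c-differs (∈-map⁺ tail (∈-filter⁺ P? v∈vs pv)) in suc i , ne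
  ... | no ¬pv = zero , b≢head ¬pv

private
  head≡true? : ∀ {s} → Decidable (λ (v : Vector Bool (suc s)) → head v ≡ true)
  head≡true? v = head v ≟ᵇ true

∃-differing : ∀ s (vs : List (Vector Bool s)) → length vs < 2 ^ s → ∃ λ c → All (Differs c) vs
∃-differing zero    []      _        = (λ ()) , []
∃-differing zero    (_ ∷ _) (s≤s ())
∃-differing (suc s) vs few with half-< (subst (_< 2 ^ suc s) (sym (length-filter-∁ head≡true? vs)) few)
... | inj₁ few′ = differing-step (∃-differing s) vs true head≡true? (λ ¬t → ¬t ∘ sym) few′
... | inj₂ few′ = differing-step (∃-differing s) vs false (∁? head≡true?)
                                (λ ¬¬t f≡h → ¬¬t (not-¬ (sym f≡h))) few′

private module _ (e f g : Bool) where

  flip₁₂ : (not e xor not f) xor g ≡ (e xor f) xor g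
  flip₁₂ = cong (_xor g) (xor-annihilates-not e f)

  flip₁₃ : (not e xor f) xor not g ≡ (e xor f) xor g
  flip₁₃ = trans (cong (_xor not g) (sym (not-distribˡ-xor e f))) (xor-annihilates-not (e xor f) g)

  flip₂₃ : (e xor not f) xor not g ≡ (e xor f) xor g
  flip₂₃ = trans (cong (_xor not g) (sym (not-distribʳ-xor e f))) (xor-annihilates-not (e xor f) g)

xor-switch-triangle : ∀ α β γ e f g →
  (((α xor β) xor e) xor ((α xor γ) xor f)) xor ((β xor γ) xor g) ≡ (e xor f) xor g
xor-switch-triangle false false false e f g = refl
xor-switch-triangle false false true  e f g = flip₂₃ e f g
xor-switch-triangle false true  false e f g = flip₁₃ e f g
xor-switch-triangle false true  true  e f g = flip₁₂ e f g
xor-switch-triangle true  false false e f g = flip₁₂ e f g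
xor-switch-triangle true  false true  e f g = flip₁₃ e f g
xor-switch-triangle true  true  false e f g = flip₂₃ e f g
xor-switch-triangle true  true  true  e f g = refl

≢⇒xor≡true : ∀ {a b} → a ≢ b → a xor b ≡ true
≢⇒xor≡true {a} {b} a≢b = trans (cong (_xor b) (¬-not a≢b)) (xor-inverseˡ b)

even-triangle : ∀ b c → (true xor b) xor c ≡ false → b ≡ true ⊎ c ≡ true
even-triangle true  _     _  = inj₁ refl
even-triangle false true  _  = inj₂ refl
even-triangle false false ()

-- Complete minors

module _ {n} {G : Graph n} {P : Fin n → Set} where

  walk-source : ∀ {u v} → WalkIn G P u v → P u
  walk-source (here pu)     = pu
  walk-source (step pu _ _) = pu

  walk-++ : ∀ {u v w} → WalkIn G P u v → WalkIn G P v w → WalkIn G P u w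
  walk-++ (here _)      q = q
  walk-++ (step pu e r) q = step pu e (walk-++ r q)

  walk-reverse : ∀ {u v} → WalkIn G P u v → WalkIn G P v u
  walk-reverse (here pu) = here pu
  walk-reverse {u} (step {w = w} pu e r) =
    walk-++ (walk-reverse r) (step (walk-source r) (trans (adjSym G w u) e) (here pu))

walk-mono : ∀ {n} {G : Graph n} {P Q : Fin n → Set} → (∀ {w} → P w → Q w) →
            ∀ {u v} → WalkIn G P u v → WalkIn G Q u v
walk-mono f (here pu)     = here (f pu)
walk-mono f (step pu e r) = step (f pu) e (walk-mono f r)

adjacent⇒distinct : ∀ {n} (G : Graph n) {u v} → adj G u v ≡ true → u ≢ v
adjacent⇒distinct G {u} e refl with trans (sym e) (loopless G u)
... | ()

module _ {p m n} (g : Fin p → Fin m → Fin n) {B : Set} where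

  extend : (Fin p → Fin m → B) → B → Fin n → B
  extend f d v with any? (λ i → any? (λ k → g i k ≟ v))
  ... | yes (i , k , _) = f i k
  ... | no _            = d

  extend-at : ∀ {f d} → (∀ {i k j l} → g i k ≡ g j l → f i k ≡ f j l) →
              ∀ i k → extend f d (g i k) ≡ f i k
  extend-at resp i k with any? (λ j → any? (λ l → g j l ≟ g i k))
  ... | yes (j , l , e) = resp e
  ... | no ∄            = contradiction (i , k , refl) ∄

  extend-cases : ∀ f d v → extend f d v ≡ d ⊎ ∃₂ λ i k → g i k ≡ v × extend f d v ≡ f i k
  extend-cases f d v with any? (λ i → any? (λ k → g i k ≟ v))
  ... | yes (i , k , e) = inj₂ (i , k , e , refl)
  ... | no _            = inj₁ refl

InBranch : ∀ {p m n} → (Fin p → Fin m → Fin n) → Fin p → Fin n → Set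
InBranch g i v = ∃ λ k → g i k ≡ v

record CompleteMinorModel {n} (G : Graph n) (p m : ℕ) : Set where
  field
    branch    : Fin p → Fin (suc m) → Fin n
    disjoint  : ∀ {i k j l} → branch i k ≡ branch j l → i ≡ j
    connected : ∀ i k → WalkIn G (InBranch branch i) (branch i k) (branch i zero)
    linked    : ∀ {i j} → i ≢ j → ∃₂ λ k l → adj G (branch i k) (branch j l) ≡ true

model⇒minor : ∀ {n p m} {G : Graph n} → CompleteMinorModel G p m → (H : Graph p) → H ≼ G
model⇒minor {n} {p} {G = G} M H = branchOf , nonempty , walks , edges
  where
  open CompleteMinorModel M

  branchOf : Fin n → Maybe (Fin p)
  branchOf = extend branch (λ i _ → just i) nothing

  branchOf-at : ∀ i k → branchOf (branch i k) ≡ just i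
  branchOf-at = extend-at branch (cong just ∘ disjoint)

  branchOf-sound : ∀ {i v} → branchOf v ≡ just i → InBranch branch i v
  branchOf-sound {i} {v} eq with extend-cases branch (λ i _ → just i) nothing v
  ... | inj₁ none = contradiction (trans (sym none) eq) λ ()
  ... | inj₂ (j , k , e , some) with trans (sym some) eq
  ...   | refl = k , e

  nonempty : ∀ i → ∃ λ u → branchOf u ≡ just i
  nonempty i = branch i zero , branchOf-at i zero

  walks : ∀ i u v → branchOf u ≡ just i → branchOf v ≡ just i →
          WalkIn G (λ w → branchOf w ≡ just i) u v
  walks i u v eu ev with branchOf-sound eu | branchOf-sound ev
  ... | k , refl | l , refl =
    walk-mono (λ { (k , refl) → branchOf-at i k })
              (walk-++ (connected i k) (walk-reverse (connected i l)))

  edges : ∀ i j → adj H i j ≡ true →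
          ∃ λ u → ∃ λ v → branchOf u ≡ just i × branchOf v ≡ just j × adj G u v ≡ true
  edges i j e with linked (adjacent⇒distinct H e)
  ... | k , l , e′ = branch i k , branch j l , branchOf-at i k , branchOf-at j l , e′

record Clique {n} (G : Graph n) (p : ℕ) (xs : List (Fin n)) : Set where
  constructor clique
  field
    vertex   : Fin p → Fin n
    vertex-∈ : ∀ i → vertex i ∈ xs
    adjacent : ∀ {i j} → i ≢ j → adj G (vertex i) (vertex j) ≡ true

clique-⊆ : ∀ {n p xs ys} {G : Graph n} → (∀ {z} → z ∈ xs → z ∈ ys) →
           Clique G p xs → Clique G p ys
clique-⊆ xs⊆ys (clique f f∈xs f-adj) = clique f (xs⊆ys ∘ f∈xs) f-adj

clique⇒model : ∀ {n p xs} {G : Graph n} → Clique G p xs → CompleteMinorModel G p 0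
clique⇒model {G = G} (clique f _ adjacent) = record
  { branch    = λ i _ → f i
  ; disjoint  = λ {i} {_} {j} → f-injective
  ; connected = λ { i zero → here (zero , refl) }
  ; linked    = λ i≢j → zero , zero , adjacent i≢j
  }
  where
  f-injective : ∀ {i j} → f i ≡ f j → i ≡ j
  f-injective {i} {j} e with i ≟ j
  ... | yes i≡j = i≡j
  ... | no  i≢j = contradiction e (adjacent⇒distinct G (adjacent i≢j))

-- Switching and the greedy construction

-- By definition of switching, parity G x a b is also adj (switch G (adj G x)) a b.
parity : ∀ {n} → Graph n → Fin n → Fin n → Fin n → Bool
parity G x a b = (adj G x a xor adj G x b) xor adj G a b

parity-switch : ∀ {n} (G : Graph n) A x a b → parity (switch G A) x a b ≡ parity G x a b
parity-switch G A x a b = xor-switch-triangle (A x) (A a) (A b) (adj G x a) (adj G x b) (adj G a b)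

module _ {n} (S : Graph n) where

  adjacent? : ∀ u → Decidable (λ v → adj S u v ≡ true)
  adjacent? u v = adj S u v ≟ᵇ true

  -- Being loopless, u is one of its own non-neighbours.
  neighbours nonNeighbours : Fin n → List (Fin n) → List (Fin n)
  neighbours    u = filter (adjacent? u)
  nonNeighbours u = filter (∁? (adjacent? u))

  ∃-clique : ∀ {s} p xs → p * s < length xs →
             All (λ y → length (nonNeighbours y xs) ≤ s) xs → Clique S p xs
  ∃-clique zero    xs       _   _ = clique (λ ()) (λ ()) λ { {()} }
  ∃-clique (suc p) []       ()
  ∃-clique {s} (suc p) (y ∷ xs) big sparse = clique (y ∷ᵛ f) f∈ f-adj
    where
    ys : List (Fin n)
    ys = neighbours y xs

    nn : ℕ
    nn = length (nonNeighbours y xs)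

    ys⊆xs : ∀ {z} → z ∈ ys → z ∈ xs × adj S y z ≡ true
    ys⊆xs = ∈-filter⁻ (adjacent? y) {xs = xs}

    y-sparse : suc nn ≤ s
    y-sparse = subst (_≤ s)
      (cong length (filter-accept (∁? (adjacent? y)) (λ e → adjacent⇒distinct S e refl)))
      (All.head sparse)

    ys-big : p * s < length ys
    ys-big = +-cancelˡ-< s _ _ (begin-strict
      s + p * s       ≤⟨ ≤-pred big ⟩
      length xs       ≡⟨ sym (length-filter-∁ (adjacent? y) xs) ⟩
      length ys + nn  <⟨ +-monoʳ-< (length ys) y-sparse ⟩
      length ys + s   ≡⟨ +-comm (length ys) s ⟩
      s + length ys   ∎)
      where open ≤-Reasoning

    ys-sparse : All (λ z → length (nonNeighbours z ys) ≤ s) ys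
    ys-sparse = All.tabulate λ {z} z∈ys → ≤-trans
      (length-mono-≤ (filter⁺ (∁? (adjacent? z)) (∁? (adjacent? z)) (λ { refl → id })
                              (y ∷ʳ filter-⊆ (adjacent? y) xs)))
      (All.lookup sparse (there (proj₁ (ys⊆xs z∈ys))))

    open Clique (∃-clique p ys ys-big ys-sparse)
      renaming (vertex to f; vertex-∈ to f∈ys; adjacent to f′-adj)

    f∈ : ∀ i → (y ∷ᵛ f) i ∈ y ∷ xs
    f∈ zero    = here refl
    f∈ (suc i) = there (proj₁ (ys⊆xs (f∈ys i)))

    f-adj : ∀ {i j} → i ≢ j → adj S ((y ∷ᵛ f) i) ((y ∷ᵛ f) j) ≡ true
    f-adj {zero}  {zero}  i≢j = contradiction refl i≢j
    f-adj {zero}  {suc j} _   = proj₂ (ys⊆xs (f∈ys j))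
    f-adj {suc i} {zero}  _   = trans (adjSym S (f i) y) (proj₂ (ys⊆xs (f∈ys i)))
    f-adj {suc i} {suc j} i≢j = f′-adj (i≢j ∘ cong suc)

-- Block u consists of a centre (index 0), a hub (index 1) and s leaves.
record Blocks {n} (G : Graph n) (s k : ℕ) (U : List (Fin n)) : Set where
  field
    vertex    : Fin k → Vector (Fin n) (2 + s)
    injective : ∀ {u j v l} → vertex u j ≡ vertex v l → u ≡ v × j ≡ l
    vertex-∈  : ∀ u j → vertex u j ∈ U
    even      : ∀ u i → parity G (vertex u zero) (vertex u (suc zero)) (vertex u (suc (suc i))) ≡ false

module _ {n} {G : Graph n} {s : ℕ} where

  no-blocks : ∀ {U} → Blocks G s 0 U
  no-blocks = record { vertex = λ (); injective = λ { {()} }; vertex-∈ = λ (); even = λ () }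

  add-block : ∀ {k U U′} {b : Vector (Fin n) (2 + s)} →
    (∀ {j l} → b j ≡ b l → j ≡ l) →
    (∀ i → parity G (b zero) (b (suc zero)) (b (suc (suc i))) ≡ false) →
    (∀ j → b j ∈ U) → (∀ j → b j ∉ U′) → (∀ {z} → z ∈ U′ → z ∈ U) →
    Blocks G s k U′ → Blocks G s (suc k) U
  add-block {U′ = U′} {b} b-injective b-even b∈U b∉U′ U′⊆U B = record
    { vertex    = b ∷ᵛ vertex
    ; injective = injective′
    ; vertex-∈  = λ { zero j → b∈U j ; (suc u) j → U′⊆U (vertex-∈ u j) }
    ; even      = λ { zero → b-even ; (suc u) → even u }
    }
    where
    open Blocks B
    injective′ : ∀ {u j v l} → (b ∷ᵛ vertex) u j ≡ (b ∷ᵛ vertex) v l → u ≡ v × j ≡ l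
    injective′ {zero}  {_} {zero}  {_} e = refl , b-injective e
    injective′ {zero}  {j} {suc v} {l} e = ⊥-elim (b∉U′ j (subst (_∈ U′) (sym e) (vertex-∈ v l)))
    injective′ {suc u} {j} {zero}  {l} e = ⊥-elim (b∉U′ l (subst (_∈ U′) e (vertex-∈ u j)))
    injective′ {suc u} {_} {suc v} {_} e with injective e
    ... | refl , j≡l = refl , j≡l

module DenseBlock {n} (G : Graph n) {s} {x : Fin n} {R : List (Fin n)} (x∉R : x ∉ R) (uR : Unique R)
                  {y} (y∈R : y ∈ R) (dense : s < length (nonNeighbours (switch G (adj G x)) y R)) where

  open Removal {A = Fin n} _≟_

  private
    Sₓ : Graph n
    Sₓ = switch G (adj G x)

    NN candidates : List (Fin n)
    NN         = nonNeighbours Sₓ y R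
    candidates = NN ∖ (y ∷ [])

    unique-NN : Unique NN
    unique-NN = Unique.filter⁺ (∁? (adjacent? Sₓ y)) uR

    s≤candidates : s ≤ length candidates
    s≤candidates = ≤-pred (subst (s <_)
      (trans (sym (length-∖ unique-NN ([] ∷ []) (y∈NN ∷ []))) (+-comm (length candidates) 1)) dense)
      where
      y∈NN : y ∈ NN
      y∈NN = ∈-filter⁺ (∁? (adjacent? Sₓ y)) y∈R (λ e → adjacent⇒distinct Sₓ e refl)

  leaf : Vector (Fin n) s
  leaf i = lookup candidates (inject≤ i s≤candidates)

  private
    leaf-candidate : ∀ i → leaf i ∈ NN × leaf i ∉ y ∷ []
    leaf-candidate i = ∈-∖⁻ NN (y ∷ []) (∈-lookup _)

    leaf-NN : ∀ i → leaf i ∈ R × adj Sₓ y (leaf i) ≢ true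
    leaf-NN i = ∈-filter⁻ (∁? (adjacent? Sₓ y)) {xs = R} (proj₁ (leaf-candidate i))

    leaf≢y : ∀ i → leaf i ≢ y
    leaf≢y i = proj₂ (leaf-candidate i) ∘ here

    leaf-injective : ∀ {i j} → leaf i ≡ leaf j → i ≡ j
    leaf-injective e = inject≤-injective _ _ _ _ (lookup-injective (∖-unique (y ∷ []) unique-NN) e)

    hub-and-leaves∈R : ∀ j → (y ∷ᵛ leaf) j ∈ R
    hub-and-leaves∈R zero    = y∈R
    hub-and-leaves∈R (suc i) = proj₁ (leaf-NN i)

    used : List (Fin n)
    used = y ∷ tabulate leaf

  block : Vector (Fin n) (2 + s)
  block = x ∷ᵛ y ∷ᵛ leaf

  rest : List (Fin n)
  rest = R ∖ used

  block-injective : ∀ {j l} → block j ≡ block l → j ≡ l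
  block-injective = ∷ᵛ-injective (λ j e → x∉R (subst (_∈ R) e (hub-and-leaves∈R j)))
                                 (∷ᵛ-injective leaf≢y leaf-injective)

  block-even : ∀ i → parity G x y (leaf i) ≡ false
  block-even i = ¬-not (proj₂ (leaf-NN i))

  block-∈ : ∀ j → block j ∈ x ∷ R
  block-∈ zero    = here refl
  block-∈ (suc j) = there (hub-and-leaves∈R j)

  rest⊆R : ∀ {z} → z ∈ rest → z ∈ R
  rest⊆R = proj₁ ∘ ∈-∖⁻ R used

  block-∉-rest : ∀ j → block j ∉ rest
  block-∉-rest zero          = x∉R ∘ rest⊆R
  block-∉-rest (suc zero)    z∈ = proj₂ (∈-∖⁻ R used z∈) (here refl)
  block-∉-rest (suc (suc i)) z∈ = proj₂ (∈-∖⁻ R used z∈) (there (∈-tabulate⁺ i))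

  rest-unique : Unique rest
  rest-unique = ∖-unique used uR

  length-rest : length rest + suc s ≡ length R
  length-rest = trans (cong (λ l → length rest + suc l) (sym (length-tabulate leaf)))
                      (length-∖ uR unique-used (y∈R ∷ AllP.tabulate⁺ (proj₁ ∘ leaf-NN)))
    where
    unique-used : Unique used
    unique-used = AllP.tabulate⁺ (≢-sym ∘ leaf≢y) ∷ Unique.tabulate⁺ leaf-injective

clique-room : ∀ {k s p r} → suc k * (2 + s) + p * s < suc r → p * s < r
clique-room {k} {s} {p} big =
  ≤-trans (s≤s (≤-trans (m≤n+m (p * s) (s + k * (2 + s))) (n≤1+n _))) (≤-pred big)

block-room : ∀ {k s p r r′} → suc k * (2 + s) + p * s < suc r → r′ + suc s ≡ r →
             k * (2 + s) + p * s < r′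
block-room {k} {s} {p} {r} {r′} big refl = +-cancelˡ-< (2 + s) _ _ (begin-strict
  2 + s + (k * (2 + s) + p * s)  ≡⟨ sym (+-assoc (2 + s) (k * (2 + s)) (p * s)) ⟩
  suc k * (2 + s) + p * s        <⟨ big ⟩
  suc (r′ + suc s)               ≡⟨ cong suc (trans (+-suc r′ s) (cong suc (+-comm r′ s))) ⟩
  2 + s + r′                     ∎)
  where open ≤-Reasoning

blocks-or-clique : ∀ {n} (G : Graph n) s p k (U : List (Fin n)) → Unique U →
  k * (2 + s) + p * s < length U → Blocks G s k U ⊎ ∃ λ x → Clique (switch G (adj G x)) p U
blocks-or-clique G s p zero    U       _          _   = inj₁ no-blocks
blocks-or-clique G s p (suc k) (x ∷ R) (x≢R ∷ uR) big
  with Any.any? (λ y → s <? length (nonNeighbours (switch G (adj G x)) y R)) R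
... | no ¬dense = inj₂ (x , clique-⊆ there
  (∃-clique (switch G (adj G x)) p R (clique-room {k} {s} {p} big)
            (All.map ≮⇒≥ (¬Any⇒All¬ R ¬dense))))
... | yes dense with find dense
...   | y , y∈R , y-dense =
  Sum.map (add-block block-injective block-even block-∈ block-∉-rest (there ∘ rest⊆R))
          (Product.map₂ (clique-⊆ (there ∘ rest⊆R)))
          (blocks-or-clique G s p k rest rest-unique (block-room {k} {s} {p} big length-rest))
  where open DenseBlock G (All¬⇒¬Any x≢R) uR y∈R y-dense

module _ {n} {G : Graph n} {s p U} (B : Blocks G s p U) (p<2^s : p < 2 ^ s) where

  open Blocks B

  private
    centre hub : Fin p → Fin n
    centre u = vertex u zero
    hub    u = vertex u (suc zero)

    leaf : Fin p → Vector (Fin n) s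
    leaf u i = vertex u (suc (suc i))

    centreOnLeaves : Fin p → Fin p → Vector Bool s
    centreOnLeaves t u i = adj G (centre t) (leaf u i)

    codes : ∀ u → ∃ λ c → All (Differs c) (tabulate λ t → centreOnLeaves t u)
    codes u = ∃-differing s _ (subst (_< 2 ^ s) (sym (length-tabulate _)) p<2^s)

    code : Fin p → Vector Bool s
    code u = proj₁ (codes u)

    code-differs : ∀ t u → Differs (code u) (centreOnLeaves t u)
    code-differs t u = AllP.tabulate⁻ (proj₂ (codes u)) t

    label : Fin p → Vector Bool (2 + s)
    label u = false ∷ᵛ not (adj G (centre u) (hub u)) ∷ᵛ code u

    A : Fin n → Bool
    A = extend vertex label false

    S : Graph n
    S = switch G A

    label-respects : ∀ {u j v l} → vertex u j ≡ vertex v l → label u j ≡ label v l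
    label-respects e with injective e
    ... | refl , refl = refl

    adj-S : ∀ u j v l → adj S (vertex u j) (vertex v l) ≡
                        (label u j xor label v l) xor adj G (vertex u j) (vertex v l)
    adj-S u j v l = cong₂ (λ a b → (a xor b) xor adj G (vertex u j) (vertex v l))
                          (extend-at vertex label-respects u j) (extend-at vertex label-respects v l)

    centre-hub : ∀ u → adj S (centre u) (hub u) ≡ true
    centre-hub u = trans (adj-S u zero u (suc zero)) (xor-inverseˡ (adj G (centre u) (hub u)))

    leaf-attached : ∀ u i → adj S (centre u) (leaf u i) ≡ true ⊎ adj S (hub u) (leaf u i) ≡ true
    leaf-attached u i = even-triangle _ _ (begin
      (true xor adj S (centre u) (leaf u i)) xor adj S (hub u) (leaf u i)
        ≡⟨ cong (λ b → (b xor adj S (centre u) (leaf u i)) xor adj S (hub u) (leaf u i))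
                (sym (centre-hub u)) ⟩
      parity S (centre u) (hub u) (leaf u i)  ≡⟨ parity-switch G A (centre u) (hub u) (leaf u i) ⟩
      parity G (centre u) (hub u) (leaf u i)  ≡⟨ even u i ⟩
      false                                   ∎)
      where open ≡-Reasoning

    connected : ∀ u j → WalkIn S (InBranch vertex u) (vertex u j) (centre u)
    connected u zero          = here (zero , refl)
    connected u (suc zero)    = step (suc zero , refl) (trans (adjSym S _ _) (centre-hub u)) (here (zero , refl))
    connected u (suc (suc i)) with leaf-attached u i
    ... | inj₁ e = step (suc (suc i) , refl) (trans (adjSym S _ _) e) (here (zero , refl))
    ... | inj₂ e = step (suc (suc i) , refl) (trans (adjSym S _ _) e) (connected u (suc zero))

    linked : ∀ t u → ∃₂ λ j l → adj S (vertex t j) (vertex u l) ≡ true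
    linked t u with code-differs t u
    ... | ι , ne = zero , suc (suc ι) , trans (adj-S t zero u (suc (suc ι))) (≢⇒xor≡true ne)

  blocks⇒switched-model : ∃ λ A → CompleteMinorModel (switch G A) p (suc s)
  blocks⇒switched-model = A , record
    { branch    = vertex
    ; disjoint  = proj₁ ∘ injective
    ; connected = connected
    ; linked    = λ {t} {u} _ → linked t u
    }

switching-with-complete-minor : ∀ {n} (G : Graph n) {p s} → p < 2 ^ s → p * (2 + s) + p * s < n →
                                ∃ λ A → (H : Graph p) → H ≼ switch G A
switching-with-complete-minor {n} G {p} {s} p<2^s big
  with blocks-or-clique G s p p (allFin n) (Unique.allFin⁺ n) (subst (_ <_) (sym (length-tabulate id)) big)
... | inj₁ B       = Product.map₂ model⇒minor (blocks⇒switched-model B p<2^s)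
... | inj₂ (x , K) = adj G x , model⇒minor (clique⇒model K)

-- Arithmetic

∃-2^-bracket : ∀ p → ∃ λ s → p < 2 ^ s × 2 ^ s ≤ suc (2 * p)
∃-2^-bracket zero = 0 , s≤s z≤n , s≤s z≤n
∃-2^-bracket (suc p) with ∃-2^-bracket p
... | s , p<2^s , 2^s≤ with suc p <? 2 ^ s
...   | yes p+1<2^s = s , p+1<2^s , ≤-trans 2^s≤ (s≤s (*-monoʳ-≤ 2 (n≤1+n p)))
...   | no  p+1≮2^s = suc s , subst (λ m → suc p < 2 * m × 2 * m ≤ suc (2 * suc p))
                                    (≤∧≮⇒≡ p<2^s p+1≮2^s) (m<m+n (suc p) (s≤s z≤n) , n≤1+n _)

2+2t≤2^[1+t] : ∀ t → 2 + 2 * t ≤ 2 ^ suc t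
2+2t≤2^[1+t] zero    = ≤-refl
2+2t≤2^[1+t] (suc t) = begin
  2 + 2 * suc t          ≡⟨ 2+2[1+t]≡2+2t+2 t ⟩
  (2 + 2 * t) + 2        ≤⟨ +-mono-≤ (2+2t≤2^[1+t] t)
                                      (≤-trans (m≤m+n 2 (2 * t)) (2+2t≤2^[1+t] t)) ⟩
  2 ^ suc t + 2 ^ suc t  ≡⟨ sym (2*m≡m+m (2 ^ suc t)) ⟩
  2 ^ suc (suc t)        ∎
  where
  open ≤-Reasoning

  2+2[1+t]≡2+2t+2 : ∀ t → 2 + 2 * suc t ≡ (2 + 2 * t) + 2
  2+2[1+t]≡2+2t+2 = solve-∀

t²≤2^[1+t] : ∀ t → t * t ≤ 2 ^ suc t
t²≤2^[1+t] zero    = z≤n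
t²≤2^[1+t] (suc t) = begin
  suc t * suc t          ≡⟨ [1+t]²≡t²+[1+2t] t ⟩
  t * t + suc (2 * t)    ≤⟨ +-mono-≤ (t²≤2^[1+t] t) (≤-trans (n≤1+n _) (2+2t≤2^[1+t] t)) ⟩
  2 ^ suc t + 2 ^ suc t  ≡⟨ sym (2*m≡m+m (2 ^ suc t)) ⟩
  2 ^ suc (suc t)        ∎
  where
  open ≤-Reasoning

  [1+t]²≡t²+[1+2t] : ∀ t → suc t * suc t ≡ t * t + suc (2 * t)
  [1+t]²≡t²+[1+2t] = solve-∀

size-bound : ∀ {n p s} → n ≤ p * (2 + s) + p * s → 2 ^ s ≤ suc (2 * p) → n * n ≤ 7 * 7 * (p * p * p)
size-bound {p = zero} z≤n _ = z≤n
size-bound {n} {p@(suc q)} {s} n≤ 2^s≤ = begin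
  n * n                                          ≤⟨ *-mono-≤ n≤ n≤ ⟩
  (p * (2 + s) + p * s) * (p * (2 + s) + p * s)  ≡⟨ square-of-2p[1+s] p s ⟩
  4 * (p * p) * (suc s * suc s)                  ≤⟨ *-monoʳ-≤ (4 * (p * p)) (t²≤2^[1+t] (suc s)) ⟩
  4 * (p * p) * (2 * (2 * 2 ^ s))
    ≤⟨ *-monoʳ-≤ (4 * (p * p)) (*-monoʳ-≤ 2 (*-monoʳ-≤ 2 2^s≤3p)) ⟩
  4 * (p * p) * (2 * (2 * (3 * p)))              ≡⟨ 48p³ p ⟩
  48 * (p * p * p)                               ≤⟨ *-monoˡ-≤ (p * p * p) (n≤1+n 48) ⟩
  7 * 7 * (p * p * p)                            ∎
  where
  open ≤-Reasoning

  square-of-2p[1+s] : ∀ p s → (p * (2 + s) + p * s) * (p * (2 + s) + p * s) ≡ 4 * (p * p) * (suc s * suc s)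
  square-of-2p[1+s] = solve-∀

  48p³ : ∀ p → 4 * (p * p) * (2 * (2 * (3 * p))) ≡ 48 * (p * p * p)
  48p³ = solve-∀

  3[1+q]≡1+2[1+q]+q : ∀ q → 3 * suc q ≡ suc (2 * suc q) + q
  3[1+q]≡1+2[1+q]+q = solve-∀

  2^s≤3p : 2 ^ s ≤ 3 * p
  2^s≤3p = ≤-trans 2^s≤ (subst (suc (2 * p) ≤_) (sym (3[1+q]≡1+2[1+q]+q q)) (m≤m+n _ q))

switching-equivalent : ∀ {n} (G : Graph n) A → SwitchingEquivalent (switch G A) G
switching-equivalent {n} G A = A , ↔-id (Fin n) , λ _ _ → refl

no-switching-minor⇒size-bound : ∀ {n p} (G : Graph n) (H : Graph p) → (∀ A → ¬ H ≼ switch G A) →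
                                n * n ≤ 7 * 7 * (p * p * p)
no-switching-minor⇒size-bound {n} {p} G H no-minor with ∃-2^-bracket p
... | s , p<2^s , 2^s≤ with p * (2 + s) + p * s <? n
...   | no  small = size-bound {n} {p} {s} (≮⇒≥ small) 2^s≤
...   | yes big   = let (A , minors) = switching-with-complete-minor G p<2^s big
                    in contradiction (minors H) (no-minor A)

mainTheorem2 : Σ ℕ λ C → 0 < C ×
    ((𝒢 : GraphClass) → MinorClosed 𝒢 → Nontrivial 𝒢 →
     (p : ℕ) → MinForbiddenMinorSize 𝒢 p →
     ∀ {n} (G : Graph n) → LowerSwitchingClass 𝒢 G →
     n * n ≤ (C * C) * (p * p * p))
mainTheorem2 = 7 , s≤s z≤n , λ 𝒢 minor-closed _ p ((H , H∉𝒢 , _) , _) G lower →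
  no-switching-minor⇒size-bound G H λ A H≼SA →
    H∉𝒢 (minor-closed (switch G A) H (lower (switch G A) (switching-equivalent G A)) H≼SA)
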